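{- Let $d,\ell\geq 1$ be integers and let $v_1,\dots,v_\ell\in\mathbb{Z}^d$. There exists a constant $C_{\ell,d}=C_{\ell,d}(v_1,\dots,v_\ell)$ such that for every positive integer $N$ and every set $A\subseteq[1,N]^d$ with \[\frac{|A|}{N^d}\geq C_{\ell,d}\,N^{ -1/\ell},\] there exists an integer $r>0$ such that \[\{rv_1,\dots,rv_\ell\}\subseteq A-A.\]
   Context: $[1,N]=\{1,2,\dots,N\}$ and $[1,N]^d$ is its $d$-fold Cartesian product. $A-A=\{a-a' : a,a'\in A\}$ denotes the difference set of $A$. -}

module Defs where

open import Data.Nat using (ℕ; _≤_)
open import Data.Integer as ℤ using (ℤ; +_)
open import Data.Vec using (Vec; zipWith; map)
open import Data.Vec.Relation.Unary.All as VAll using ()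
open import Data.List using (List)
open import Data.List.Membership.Propositional using (_∈_)
open import Data.Product using (∃-syntax; _×_)
open import Relation.Binary.PropositionalEquality using (_≡_)

InBox : ∀ {d} → ℕ → Vec ℤ d → Set
InBox N x = VAll.All (λ xi → (+ 1 ℤ.≤ xi) × (xi ℤ.≤ + N)) x

_-ᵥ_ : ∀ {d} → Vec ℤ d → Vec ℤ d → Vec ℤ d
x -ᵥ y = zipWith ℤ._-_ x y

scale : ∀ {d} → ℤ → Vec ℤ d → Vec ℤ d
scale r v = map (r ℤ.*_) v

_∈Diff_ : ∀ {d} → Vec ℤ d → List (Vec ℤ d) → Set
w ∈Diff A = ∃[ a ] ∃[ a' ] (a ∈ A × a' ∈ A × w ≡ a -ᵥ a')

-- Fix a nonzero coordinate c = (v i₀) j₀.  To an ℓ-tuple t of points of A attach the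
-- integer quotient q(t) = (t i₀) j₀ / c and the reduced tuple i ↦ t i − q(t) v i.  Its
-- (i₀, j₀) coordinate is the remainder (t i₀) j₀ mod c ∈ [0, |c|) and all its coordinates
-- are bounded by some R = O(N), so the reduced tuples lie in a box of |c| (2R + 1)^(ℓd − 1)
-- points.  The density hypothesis makes |A|^ℓ larger than that, so two distinct tuples
-- t, t' have the same reduction.  Then t i − t' i = (q(t) − q(t')) v i for every i, so
-- q(t) ≠ q(t') and r = |q(t) − q(t')| works.  If all v i vanish, any r works since A is
-- nonempty.
module Submission where

open import Defs
open import Data.Nat using (ℕ)
open import Data.Integer using (ℤ; 0ℤ)
open import Data.Fin using (Fin)
open import Data.Vec using (Vec; lookup)
open import Function using (_∘_; id)
open import Data.Product using (∃-syntax; ∃₂; _×_; _,_; proj₁; proj₂; uncurry)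
open import Relation.Binary.PropositionalEquality
  using (_≡_; _≢_; _≗_; refl; sym; trans; cong; cong₂; subst; module ≡-Reasoning)
open import Relation.Nullary using (yes; no; contradiction)

module _ where
  open import Data.Nat using (zero; suc; _+_; _^_; _≤_)
  open import Data.Nat.Properties using (m≤m+n; m≤n+m; ≤-trans)
  open import Data.Fin using (zero; suc; combine; remQuot; funToFin; finToFun; punchIn; punchOut; _≟_)
  open import Data.Fin.Properties using (finToFun-funToFin; funToFin-finToFin; punchIn-punchOut; remQuot-combine)
  open import Data.List as List using (List)
  open import Data.List.Relation.Unary.All as All using ()
  open import Data.List.Relation.Unary.AllPairs using (_∷_)
  open import Data.List.Relation.Unary.Unique.Propositional using (Unique)
  open import Data.List.Membership.Propositional.Properties using (∈-lookup)
  open import Data.Vec using (tabulate)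
  open import Data.Vec.Properties using (tabulate∘lookup; tabulate-cong)
  open ≡-Reasoning

  lookup-injective : ∀ {A : Set} {xs : List A} → Unique xs →
    ∀ {i j} → List.lookup xs i ≡ List.lookup xs j → i ≡ j
  lookup-injective (_ ∷ _) {zero} {zero} _ = refl
  lookup-injective (x∉xs ∷ _) {zero} {suc j} eq = contradiction eq (All.lookup x∉xs (∈-lookup j))
  lookup-injective (x∉xs ∷ _) {suc i} {zero} eq = contradiction (sym eq) (All.lookup x∉xs (∈-lookup i))
  lookup-injective (_ ∷ unique) {suc i} {suc j} eq = cong suc (lookup-injective unique eq)

  funToFin-cong : ∀ {m n} {f g : Fin m → Fin n} → f ≗ g → funToFin f ≡ funToFin g
  funToFin-cong {zero} _ = refl
  funToFin-cong {suc m} f≗g = cong₂ combine (f≗g zero) (funToFin-cong (f≗g ∘ suc))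

  funToFin-injective : ∀ {m n} {f g : Fin m → Fin n} → funToFin f ≡ funToFin g → f ≗ g
  funToFin-injective {f = f} {g} eq i = begin
    f i                      ≡⟨ finToFun-funToFin f i ⟨
    finToFun (funToFin f) i  ≡⟨ cong (λ k → finToFun k i) eq ⟩
    finToFun (funToFin g) i  ≡⟨ finToFun-funToFin g i ⟩
    g i                      ∎

  finToFun-injective : ∀ {m n} {k k' : Fin (m ^ n)} → finToFun {m} {n} k ≗ finToFun k' → k ≡ k'
  finToFun-injective {m} {n} {k} {k'} eq = begin
    k                                ≡⟨ funToFin-finToFin {n} {m} k ⟨
    funToFin (finToFun {m} {n} k)    ≡⟨ funToFin-cong eq ⟩
    funToFin (finToFun {m} {n} k')   ≡⟨ funToFin-finToFin {n} {m} k' ⟩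
    k'                               ∎

  bounded : ∀ {n} (f : Fin n → ℕ) → ∃[ M ] (∀ i → f i ≤ M)
  bounded {zero} f = 0 , λ ()
  bounded {suc n} f =
    let M , f∘suc≤M = bounded (f ∘ suc)
    in f zero + M , λ { zero → m≤m+n (f zero) M ; (suc i) → ≤-trans (f∘suc≤M i) (m≤n+m M (f zero)) }

  bounded₂ : ∀ {m n} (f : Fin m → Fin n → ℕ) → ∃[ M ] (∀ i j → f i j ≤ M)
  bounded₂ f =
    let M , rows≤M = bounded (λ i → proj₁ (bounded (f i)))
    in M , λ i j → ≤-trans (proj₂ (bounded (f i)) j) (rows≤M i)

  tuples : ∀ {B : Set} ℓ (A : List B) → Fin (List.length A ^ ℓ) → Fin ℓ → B
  tuples ℓ A k i = List.lookup A (finToFun k i)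

  tuples-injective : ∀ {B : Set} {ℓ} {A : List B} → Unique A →
    ∀ {k k'} → (∀ i → tuples ℓ A k i ≡ tuples ℓ A k' i) → k ≡ k'
  tuples-injective unique same = finToFun-injective (λ i → lookup-injective unique (same i))

  punchIn-ext : ∀ {m} {B : Set} {f g : Fin (suc m) → B} (p : Fin (suc m)) →
    f p ≡ g p → (∀ u → f (punchIn p u) ≡ g (punchIn p u)) → f ≗ g
  punchIn-ext {f = f} {g} p same-p same-rest q with p ≟ q
  ... | yes refl = same-p
  ... | no p≢q = subst (λ q → f q ≡ g q) (punchIn-punchOut p≢q) (same-rest (punchOut p≢q))

  remQuot-≗ : ∀ {m n} {B : Set} (f g : Fin m → Fin n → B) →
    uncurry f ∘ remQuot n ≗ uncurry g ∘ remQuot n → ∀ i j → f i j ≡ g i j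
  remQuot-≗ f g eq i j = subst (λ ij → uncurry f ij ≡ uncurry g ij) (remQuot-combine i j) (eq (combine i j))

  lookup-≗⇒≡ : ∀ {A : Set} {n} {x y : Vec A n} → (∀ j → lookup x j ≡ lookup y j) → x ≡ y
  lookup-≗⇒≡ {x = x} {y} eq = begin
    x                    ≡⟨ tabulate∘lookup x ⟨
    tabulate (lookup x)  ≡⟨ tabulate-cong eq ⟩
    tabulate (lookup y)  ≡⟨ tabulate∘lookup y ⟩
    y                    ∎

module _ where
  open import Data.Nat as ℕ using (suc; z≤n; s≤s)
  import Data.Nat.Properties as ℕ
  open import Data.Integer hiding (suc)
  open import Data.Integer.Properties hiding (suc-mono)
  open import Data.Integer.DivMod using (a≡a%n+[a/n]*n)
  open import Data.Integer.Tactic.RingSolver using (solve-∀)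
  open import Data.Fin using (zero; suc)
  open import Data.List using (List)
  open import Data.Vec using ([]; _∷_)
  open import Data.Vec.Properties using (∷-injectiveˡ; ∷-injectiveʳ)
  open ≡-Reasoning

  [a/n]*n≡a-a%n : ∀ a n .{{_ : NonZero n}} → (a / n) * n ≡ a - + (a % n)
  [a/n]*n≡a-a%n a n = begin
    (a / n) * n                          ≡⟨ identity (+ (a % n)) ((a / n) * n) ⟩
    + (a % n) + (a / n) * n - + (a % n)  ≡⟨ cong (_- + (a % n)) (a≡a%n+[a/n]*n a n) ⟨
    a - + (a % n)                        ∎
    where
    identity : ∀ r x → x ≡ r + x - r
    identity = solve-∀

  ∣i∣≤n⇒0≤i+n : ∀ i {n} → ∣ i ∣ ℕ.≤ n → 0ℤ ≤ i + + n
  ∣i∣≤n⇒0≤i+n (+ _) _ = +≤+ z≤n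
  ∣i∣≤n⇒0≤i+n -[1+ _ ] m<n rewrite ⊖-≥ m<n = +≤+ z≤n

  ∣i∣≤n⇒∣i+n∣<1+2n : ∀ i {n} → ∣ i ∣ ℕ.≤ n → ∣ i + + n ∣ ℕ.< suc (n ℕ.+ n)
  ∣i∣≤n⇒∣i+n∣<1+2n i {n} ∣i∣≤n = s≤s (ℕ.≤-trans (∣i+j∣≤∣i∣+∣j∣ i (+ n)) (ℕ.+-monoˡ-≤ n ∣i∣≤n))

  x-aw≡y-bw⇒x-y≡[a-b]w : ∀ {n} (x y w : Vec ℤ n) {a b} →
    x -ᵥ scale a w ≡ y -ᵥ scale b w → x -ᵥ y ≡ scale (a - b) w
  x-aw≡y-bw⇒x-y≡[a-b]w [] [] [] _ = refl
  x-aw≡y-bw⇒x-y≡[a-b]w (x ∷ xs) (y ∷ ys) (w ∷ ws) {a} {b} eq =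
    cong₂ _∷_ coordinate (x-aw≡y-bw⇒x-y≡[a-b]w xs ys ws {a} {b} (∷-injectiveʳ eq))
    where
    identity : ∀ x y a b w → x - y ≡ (x - a * w) - (y - b * w) + (a - b) * w
    identity = solve-∀
    coordinate : x - y ≡ (a - b) * w
    coordinate = begin
      x - y                                         ≡⟨ identity x y a b w ⟩
      (x - a * w) - (y - b * w) + (a - b) * w       ≡⟨ cong (λ z → z - (y - b * w) + (a - b) * w) (∷-injectiveˡ eq) ⟩
      (y - b * w) - (y - b * w) + (a - b) * w       ≡⟨ cong (_+ (a - b) * w) (+-inverseʳ (y - b * w)) ⟩
      0ℤ + (a - b) * w                              ≡⟨ +-identityˡ _ ⟩
      (a - b) * w                                   ∎

  x-y≡0w⇒x≡y : ∀ {n} (x y w : Vec ℤ n) → x -ᵥ y ≡ scale 0ℤ w → x ≡ y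
  x-y≡0w⇒x≡y [] [] [] _ = refl
  x-y≡0w⇒x≡y (x ∷ xs) (y ∷ ys) (w ∷ ws) eq =
    cong₂ _∷_ (i-j≡0⇒i≡j x y (∷-injectiveˡ eq)) (x-y≡0w⇒x≡y xs ys ws (∷-injectiveʳ eq))

  zw≡x-y⇒[-z]w≡y-x : ∀ {n} z (w x y : Vec ℤ n) → scale z w ≡ x -ᵥ y → scale (- z) w ≡ y -ᵥ x
  zw≡x-y⇒[-z]w≡y-x z [] [] [] _ = refl
  zw≡x-y⇒[-z]w≡y-x z (w ∷ ws) (x ∷ xs) (y ∷ ys) eq =
    cong₂ _∷_ coordinate (zw≡x-y⇒[-z]w≡y-x z ws xs ys (∷-injectiveʳ eq))
    where
    identity : ∀ x y → - (x - y) ≡ y - x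
    identity = solve-∀
    coordinate : - z * w ≡ y - x
    coordinate = begin
      - z * w    ≡⟨ neg-distribˡ-* z w ⟨
      - (z * w)  ≡⟨ cong -_ (∷-injectiveˡ eq) ⟩
      - (x - y)  ≡⟨ identity x y ⟩
      y - x      ∎

  zero-scale≡x-x : ∀ {n} z (w x : Vec ℤ n) → (∀ j → lookup w j ≡ 0ℤ) → scale z w ≡ x -ᵥ x
  zero-scale≡x-x z [] [] _ = refl
  zero-scale≡x-x z (w ∷ ws) (x ∷ xs) w≡0 = cong₂ _∷_ coordinate (zero-scale≡x-x z ws xs (w≡0 ∘ suc))
    where
    coordinate : z * w ≡ x - x
    coordinate = trans (cong (z *_) (w≡0 zero)) (trans (*-zeroʳ z) (sym (+-inverseʳ x)))

  ∈Diff-neg : ∀ {n} {A : List (Vec ℤ n)} z (w : Vec ℤ n) → scale z w ∈Diff A → scale (- z) w ∈Diff A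
  ∈Diff-neg z w (a , a' , a∈A , a'∈A , eq) = a' , a , a'∈A , a∈A , zw≡x-y⇒[-z]w≡y-x z w a a' eq

module _ where
  open import Data.Nat using (suc; _+_; _*_; _^_; _∸_; _<_; _≤_)
  open import Data.Integer as ℤ using (+_; ∣_∣)
  open import Data.Integer.Properties using (0≤i⇒+∣i∣≡i; +-0-abelianGroup)
  open import Algebra.Properties.AbelianGroup +-0-abelianGroup using (∙-cancelʳ)
  open import Data.Fin as Fin using (combine; funToFin; punchIn; fromℕ<)
  open import Data.Fin.Properties using (pigeonhole; combine-injective; fromℕ<-injective)
  open ≡-Reasoning

  fromℕ<-∣∣-injective : ∀ {a} {i j : ℤ} → 0ℤ ℤ.≤ i → 0ℤ ℤ.≤ j →
    .(i<a : ∣ i ∣ < a) .(j<a : ∣ j ∣ < a) → fromℕ< i<a ≡ fromℕ< j<a → i ≡ j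
  fromℕ<-∣∣-injective {i = i} {j} 0≤i 0≤j i<a j<a eq = begin
    i        ≡⟨ 0≤i⇒+∣i∣≡i 0≤i ⟨
    + ∣ i ∣  ≡⟨ cong +_ (fromℕ<-injective _ _ i<a j<a eq) ⟩
    + ∣ j ∣  ≡⟨ 0≤i⇒+∣i∣≡i 0≤j ⟩
    j        ∎

  -- A point of the box is numbered by combine: its p-th coordinate is the first digit,
  -- and funToFin numbers the other coordinates after shifting them to [0, 2R].
  box-pigeonhole : ∀ {n s} (p : Fin s) (a R : ℕ) (F : Fin n → Fin s → ℤ) →
    (∀ k → 0ℤ ℤ.≤ F k p × ∣ F k p ∣ < a) → (∀ k q → ∣ F k q ∣ ≤ R) →
    a * suc (R + R) ^ (s ∸ 1) < n → ∃₂ λ k k' → k Fin.< k' × F k ≗ F k'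
  box-pigeonhole {n} {suc m} p a R F 0≤Fp<a ∣F∣≤R count =
    let k , k' , k<k' , same = pigeonhole count code
        same-p , same-rest = combine-injective (p-digit k) _ (p-digit k') _ same
    in k , k' , k<k' , punchIn-ext p
         (fromℕ<-∣∣-injective (proj₁ (0≤Fp<a k)) (proj₁ (0≤Fp<a k')) _ _ same-p)
         (λ u → ∙-cancelʳ (+ R) _ _
           (fromℕ<-∣∣-injective (shifted-nonneg k u) (shifted-nonneg k' u) _ _ (funToFin-injective same-rest u)))
    where
    F̂ : Fin n → Fin m → ℤ
    F̂ k u = F k (punchIn p u)
    shifted-nonneg : ∀ k u → 0ℤ ℤ.≤ F̂ k u ℤ.+ + R
    shifted-nonneg k u = ∣i∣≤n⇒0≤i+n (F̂ k u) (∣F∣≤R k (punchIn p u))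
    p-digit : Fin n → Fin a
    p-digit k = fromℕ< (proj₂ (0≤Fp<a k))
    shifted-digits : Fin n → Fin m → Fin (suc (R + R))
    shifted-digits k u = fromℕ< (∣i∣≤n⇒∣i+n∣<1+2n (F̂ k u) (∣F∣≤R k (punchIn p u)))
    code : Fin n → Fin (a * suc (R + R) ^ m)
    code k = combine (p-digit k) (funToFin (shifted-digits k))

module _ where
  open import Data.Nat
  open import Data.Nat.Properties
  open import Data.Nat.Tactic.RingSolver using (solve-∀)

  ^-distribʳ-* : ∀ m n o → (m * n) ^ o ≡ m ^ o * n ^ o
  ^-distribʳ-* m n zero = refl
  ^-distribʳ-* m n (suc o) = trans (cong (m * n *_) (^-distribʳ-* m n o)) (interchange m n (m ^ o) (n ^ o))
    where
    interchange : ∀ a b c d → a * b * (c * d) ≡ a * c * (b * d)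
    interchange = solve-∀

  box<density : ∀ a b K N m {ℓ} .{{_ : NonZero N}} → 1 ≤ ℓ → b ≤ K * N →
    a * b ^ m < suc (a * K ^ m) ^ ℓ * N ^ m
  box<density a b K N m {suc ℓ} _ b≤KN = begin-strict
    a * b ^ m                 ≤⟨ *-monoʳ-≤ a (^-monoˡ-≤ m b≤KN) ⟩
    a * (K * N) ^ m           ≡⟨ cong (a *_) (^-distribʳ-* K N m) ⟩
    a * (K ^ m * N ^ m)       ≡⟨ *-assoc a (K ^ m) (N ^ m) ⟨
    a * K ^ m * N ^ m         <⟨ *-monoˡ-< (N ^ m) {{m^n≢0 N m}} (n<1+n (a * K ^ m)) ⟩
    C * N ^ m                 ≤⟨ *-monoˡ-≤ (N ^ m) (m≤m*n C (C ^ ℓ) {{m^n≢0 C ℓ}}) ⟩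
    C ^ suc ℓ * N ^ m         ∎
    where
    open ≤-Reasoning
    C = suc (a * K ^ m)

module _ where
  open import Data.Nat using (zero; suc; z≤n; s≤s; _≤_)
  open import Data.Integer as ℤ using (+_; -[1+_]; ∣_∣)
  open import Data.Integer.Properties using (drop‿+≤+)
  import Data.Vec.Membership.Propositional.Properties as Vec
  import Data.Vec.Relation.Unary.All as VAll

  InBox⇒∣∣≤ : ∀ {d N} {x : Vec ℤ d} → InBox N x → ∀ j → ∣ lookup x j ∣ ≤ N
  InBox⇒∣∣≤ {x = x} x∈box j = bound (VAll.lookup x∈box (Vec.∈-lookup j x))
    where
    bound : ∀ {N z} → + 1 ℤ.≤ z × z ℤ.≤ + N → ∣ z ∣ ≤ N
    bound {z = + _} (_ , z≤N) = drop‿+≤+ z≤N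

  ∈Diff-positive-multiple : ∀ {d ℓ} {v : Fin ℓ → Vec ℤ d} {A} z → z ≢ 0ℤ →
    (∀ i → scale z (v i) ∈Diff A) → ∃[ r ] (1 ≤ r × ((i : Fin ℓ) → scale (+ r) (v i) ∈Diff A))
  ∈Diff-positive-multiple (+ zero) z≢0 _ = contradiction refl z≢0
  ∈Diff-positive-multiple (+ suc r) _ multiples = suc r , s≤s z≤n , multiples
  ∈Diff-positive-multiple {v = v} -[1+ r ] _ multiples = suc r , s≤s z≤n , λ i → ∈Diff-neg -[1+ r ] (v i) (multiples i)

module Pivot {d ℓ : ℕ} (v : Fin ℓ → Vec ℤ d) (i₀ : Fin ℓ) (j₀ : Fin d) (pivot≢0 : lookup (v i₀) j₀ ≢ 0ℤ) where
  import Data.Nat as ℕ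
  import Data.Nat.Properties as ℕ
  open import Data.Integer hiding (suc)
  open import Data.Integer.Properties hiding (suc-mono)
  open import Data.Integer.DivMod using (n%d<d)
  open import Data.Integer.Tactic.RingSolver using (solve-∀)
  open import Data.Vec.Properties using (lookup-map; lookup-zipWith)
  open import Data.List.Membership.Propositional using (_∈_)
  open import Data.Sum using (_⊎_; inj₁; inj₂)

  pivot : ℤ
  pivot = lookup (v i₀) j₀

  instance
    pivot-nonZero : NonZero pivot
    pivot-nonZero = ≢-nonZero pivot≢0

  quot : (Fin ℓ → Vec ℤ d) → ℤ
  quot t = lookup (t i₀) j₀ / pivot

  reduce : (Fin ℓ → Vec ℤ d) → Fin ℓ → Vec ℤ d
  reduce t i = t i -ᵥ scale (quot t) (v i)

  lookup-reduce : ∀ t i j → lookup (reduce t i) j ≡ lookup (t i) j - quot t * lookup (v i) j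
  lookup-reduce t i j = trans (lookup-zipWith _-_ j (t i) _) (cong (λ z → lookup (t i) j - z) (lookup-map j (quot t *_) (v i)))

  reduce-pivot : ∀ t → lookup (reduce t i₀) j₀ ≡ + (lookup (t i₀) j₀ % pivot)
  reduce-pivot t = begin
    lookup (reduce t i₀) j₀      ≡⟨ lookup-reduce t i₀ j₀ ⟩
    s - quot t * pivot           ≡⟨ cong (λ z → s - z) ([a/n]*n≡a-a%n s pivot) ⟩
    s - (s - + (s % pivot))      ≡⟨ identity s (+ (s % pivot)) ⟩
    + (s % pivot)                ∎
    where
    open ≡-Reasoning
    s = lookup (t i₀) j₀
    identity : ∀ s r → s - (s - r) ≡ r
    identity = solve-∀

  ∣quot∣≤ : ∀ {N M} t → ∣ pivot ∣ ℕ.≤ M → ∣ lookup (t i₀) j₀ ∣ ℕ.≤ N → ∣ quot t ∣ ℕ.≤ N ℕ.+ M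
  ∣quot∣≤ {N} {M} t ∣pivot∣≤M ∣s∣≤N = begin
    ∣ quot t ∣                 ≤⟨ ℕ.m≤m*n ∣ quot t ∣ ∣ pivot ∣ ⟩
    ∣ quot t ∣ ℕ.* ∣ pivot ∣   ≡⟨ abs-* (quot t) pivot ⟨
    ∣ quot t * pivot ∣         ≡⟨ cong ∣_∣ ([a/n]*n≡a-a%n s pivot) ⟩
    ∣ s - + (s % pivot) ∣      ≤⟨ ∣i-j∣≤∣i∣+∣j∣ s (+ (s % pivot)) ⟩
    ∣ s ∣ ℕ.+ s % pivot        ≤⟨ ℕ.+-mono-≤ ∣s∣≤N (ℕ.≤-trans (ℕ.<⇒≤ (n%d<d s pivot)) ∣pivot∣≤M) ⟩
    N ℕ.+ M                    ∎
    where
    open ℕ.≤-Reasoning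
    s = lookup (t i₀) j₀

  ∣reduce∣≤ : ∀ {N M} t → (∀ i j → ∣ lookup (v i) j ∣ ℕ.≤ M) → (∀ i j → ∣ lookup (t i) j ∣ ℕ.≤ N) →
    ∀ i j → ∣ lookup (reduce t i) j ∣ ℕ.≤ N ℕ.+ (N ℕ.+ M) ℕ.* M
  ∣reduce∣≤ {N} {M} t ∣v∣≤M ∣t∣≤N i j = begin
    ∣ lookup (reduce t i) j ∣          ≡⟨ cong ∣_∣ (lookup-reduce t i j) ⟩
    ∣ x - quot t * w ∣                 ≤⟨ ∣i-j∣≤∣i∣+∣j∣ x (quot t * w) ⟩
    ∣ x ∣ ℕ.+ ∣ quot t * w ∣           ≡⟨ cong (∣ x ∣ ℕ.+_) (abs-* (quot t) w) ⟩
    ∣ x ∣ ℕ.+ ∣ quot t ∣ ℕ.* ∣ w ∣     ≤⟨ ℕ.+-mono-≤ (∣t∣≤N i j) (ℕ.*-mono-≤ ∣q∣≤N+M (∣v∣≤M i j)) ⟩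
    N ℕ.+ (N ℕ.+ M) ℕ.* M              ∎
    where
    open ℕ.≤-Reasoning
    x = lookup (t i) j
    w = lookup (v i) j
    ∣q∣≤N+M = ∣quot∣≤ t (∣v∣≤M i₀ j₀) (∣t∣≤N i₀ j₀)

  reduce-≡⇒difference : ∀ t t' i → reduce t i ≡ reduce t' i → t i -ᵥ t' i ≡ scale (quot t - quot t') (v i)
  reduce-≡⇒difference t t' i = x-aw≡y-bw⇒x-y≡[a-b]w (t i) (t' i) (v i) {quot t} {quot t'}

  reduce-collision : ∀ {A} (t t' : Fin ℓ → Vec ℤ d) → (∀ i → t i ∈ A) → (∀ i → t' i ∈ A) →
    (∀ i → reduce t i ≡ reduce t' i) →
    (∀ i → t i ≡ t' i) ⊎ ∃[ r ] (1 ℕ.≤ r × ((i : Fin ℓ) → scale (+ r) (v i) ∈Diff A))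
  reduce-collision t t' t∈A t'∈A same with quot t - quot t' ≟ 0ℤ
  ... | yes q≡q' = inj₁ λ i → x-y≡0w⇒x≡y (t i) (t' i) (v i)
          (subst (λ z → t i -ᵥ t' i ≡ scale z (v i)) q≡q' (reduce-≡⇒difference t t' i (same i)))
  ... | no q≢q' = inj₂ (∈Diff-positive-multiple (quot t - quot t') q≢q' λ i →
          t i , t' i , t∈A i , t'∈A i , sym (reduce-≡⇒difference t t' i (same i)))

module _ where
  open import Data.Nat
  open import Data.Nat.Properties
  open import Data.Nat.Tactic.RingSolver using (solve-∀)
  open import Data.Integer as ℤ using (+_; ∣_∣)
  open import Data.Integer.DivMod using (n%d<d)
  open import Data.Fin as Fin using (combine; remQuot; finToFun)
  open import Data.Fin.Properties using (remQuot-combine)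
  import Data.Fin.Properties as Finₚ
  open import Data.List using (List; []; _∷_; length)
  open import Data.List.Membership.Propositional.Properties using (∈-lookup)
  open import Data.List.Relation.Unary.Any using (here)
  open import Data.List.Relation.Unary.All as All using (All)
  open import Data.List.Relation.Unary.Unique.Propositional using (Unique)
  open import Data.Sum using ([_,_]′)

  module _ {d ℓ : ℕ} (v : Fin ℓ → Vec ℤ d) (i₀ : Fin ℓ) (j₀ : Fin d) (pivot≢0 : lookup (v i₀) j₀ ≢ 0ℤ) (M : ℕ) where
    open Pivot v i₀ j₀ pivot≢0

    radius : ℕ → ℕ
    radius N = N + (N + M) * M

    K : ℕ
    K = 3 + 2 * M + 2 * M * M

    width≤K*N : ∀ N → 1 ≤ N → suc (radius N + radius N) ≤ K * N
    width≤K*N (suc n) _ = subst (suc (radius (suc n) + radius (suc n)) ≤_) (sym (identity n M)) (m≤m+n _ _)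
      where
      identity : ∀ n M → (3 + 2 * M + 2 * M * M) * suc n
        ≡ suc ((suc n + (suc n + M) * M) + (suc n + (suc n + M) * M)) + n * (1 + 2 * M * M)
      identity = solve-∀

    reductions-collide : ∀ {n} N → (∀ i j → ∣ lookup (v i) j ∣ ≤ M) →
      (t : Fin n → Fin ℓ → Vec ℤ d) → (∀ k i j → ∣ lookup (t k i) j ∣ ≤ N) →
      ∣ pivot ∣ * suc (radius N + radius N) ^ (ℓ * d ∸ 1) < n →
      ∃₂ λ k k' → k Fin.< k' × ∀ i → reduce (t k) i ≡ reduce (t k') i
    reductions-collide {n} N ∣v∣≤M t ∣t∣≤N count =
      let k , k' , k<k' , same = box-pigeonhole (combine i₀ j₀) ∣ pivot ∣ (radius N) flat pivot-digit ∣flat∣≤radius count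
      in k , k' , k<k' , λ i → lookup-≗⇒≡ (remQuot-≗ (entries k) (entries k') same i)
      where
      entries : Fin n → Fin ℓ → Fin d → ℤ
      entries k i j = lookup (reduce (t k) i) j
      flat : Fin n → Fin (ℓ * d) → ℤ
      flat k = uncurry (entries k) ∘ remQuot d
      pivot-digit : ∀ k → 0ℤ ℤ.≤ flat k (combine i₀ j₀) × ∣ flat k (combine i₀ j₀) ∣ < ∣ pivot ∣
      pivot-digit k = subst (λ z → 0ℤ ℤ.≤ z × ∣ z ∣ < ∣ pivot ∣)
        (sym (trans (cong (uncurry (entries k)) (remQuot-combine i₀ j₀)) (reduce-pivot (t k))))
        (ℤ.+≤+ z≤n , n%d<d (lookup (t k i₀) j₀) pivot)
      ∣flat∣≤radius : ∀ k p → ∣ flat k p ∣ ≤ radius N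
      ∣flat∣≤radius k p = ∣reduce∣≤ (t k) ∣v∣≤M (∣t∣≤N k) _ _

    density-constant : ℕ
    density-constant = suc (∣ pivot ∣ * K ^ (ℓ * d ∸ 1))

    multiples-in-differences : (∀ i j → ∣ lookup (v i) j ∣ ≤ M) → 1 ≤ ℓ →
      (N : ℕ) → 1 ≤ N → (A : List (Vec ℤ d)) → Unique A → All (InBox N) A →
      density-constant ^ ℓ * N ^ (d * ℓ ∸ 1) ≤ length A ^ ℓ →
      ∃[ r ] (1 ≤ r × ((i : Fin ℓ) → scale (+ r) (v i) ∈Diff A))
    multiples-in-differences ∣v∣≤M 1≤ℓ N 1≤N A unique inBox dense =
      let k , k' , k<k' , same = reductions-collide N ∣v∣≤M (tuples ℓ A) ∣tuple∣≤N count
      in [ (λ equal → contradiction (tuples-injective unique equal) (Finₚ.<⇒≢ k<k')) , id ]′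
           (reduce-collision (tuples ℓ A k) (tuples ℓ A k') (λ _ → ∈-lookup _) (λ _ → ∈-lookup _) same)
      where
      ∣tuple∣≤N : ∀ k i j → ∣ lookup (tuples ℓ A k i) j ∣ ≤ N
      ∣tuple∣≤N k i = InBox⇒∣∣≤ (All.lookup inBox (∈-lookup (finToFun k i)))
      count : ∣ pivot ∣ * suc (radius N + radius N) ^ (ℓ * d ∸ 1) < length A ^ ℓ
      count = <-≤-trans (box<density ∣ pivot ∣ _ K N (ℓ * d ∸ 1) {{>-nonZero 1≤N}} 1≤ℓ (width≤K*N N 1≤N))
                        (subst (λ m → density-constant ^ ℓ * N ^ m ≤ length A ^ ℓ) (cong (_∸ 1) (*-comm d ℓ)) dense)

  zero-vectors-in-differences : ∀ {d ℓ} (v : Fin ℓ → Vec ℤ d) → (∀ i j → lookup (v i) j ≡ 0ℤ) → 1 ≤ ℓ →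
    ∀ m (N : ℕ) → 1 ≤ N → (A : List (Vec ℤ d)) → 1 ^ ℓ * N ^ m ≤ length A ^ ℓ →
    ∃[ r ] (1 ≤ r × ((i : Fin ℓ) → scale (+ r) (v i) ∈Diff A))
  zero-vectors-in-differences {ℓ = suc ℓ} _ _ _ m N 1≤N [] dense =
    contradiction (n≤0⇒n≡0 dense) (≢-nonZero⁻¹ (1 ^ suc ℓ * N ^ m) {{m*n≢0 _ _ {{m^n≢0 1 (suc ℓ)}} {{m^n≢0 N m {{>-nonZero 1≤N}}}}}})
  zero-vectors-in-differences v v≡0 _ _ _ _ (a ∷ _) _ =
    1 , s≤s z≤n , λ i → a , a , here refl , here refl , zero-scale≡x-x (+ 1) (v i) a (v≡0 i)

open import Data.Nat using (_≤_; _*_; _^_; _∸_)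
open import Data.Integer using (+_; ∣_∣; _≟_)
open import Data.List using (List; length)
open import Data.List.Relation.Unary.All using (All)
open import Data.List.Relation.Unary.Unique.Propositional using (Unique)
open import Data.Fin.Properties using (any?)
open import Relation.Nullary.Decidable using (¬?; decidable-stable)

theorem1p1 : (d ℓ : ℕ) → 1 ≤ d → 1 ≤ ℓ → (v : Fin ℓ → Vec ℤ d) →
    ∃[ C ] ((N : ℕ) → 1 ≤ N → (A : List (Vec ℤ d)) → Unique A → All (InBox N) A →
    C ^ ℓ * N ^ (d * ℓ ∸ 1) ≤ length A ^ ℓ →
    ∃[ r ] (1 ≤ r × ((i : Fin ℓ) → scale (+ r) (v i) ∈Diff A)))
theorem1p1 d ℓ _ 1≤ℓ v with any? (λ i → any? (λ j → ¬? (lookup (v i) j ≟ 0ℤ)))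
... | yes (i₀ , j₀ , pivot≢0) =
  let M , ∣v∣≤M = bounded₂ (λ i j → ∣ lookup (v i) j ∣)
  in density-constant v i₀ j₀ pivot≢0 M , multiples-in-differences v i₀ j₀ pivot≢0 M ∣v∣≤M 1≤ℓ
... | no no-pivot =
  1 , λ N 1≤N A _ _ → zero-vectors-in-differences v v≡0 1≤ℓ (d * ℓ ∸ 1) N 1≤N A
  where
  v≡0 : ∀ i j → lookup (v i) j ≡ 0ℤ
  v≡0 i j = decidable-stable (lookup (v i) j ≟ 0ℤ) (λ v≢0 → no-pivot (i , j , v≢0))
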